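{- Let $1<p<q$ be relatively prime integers. For each integer $n$ with $p+q-2\le n\le p+q+2p\lfloor q/p\rfloor$, we have $H(n,p,q)\le H^s(n,p,q)$.
   Context: A partial word is a sequence over $\Sigma\cup\{\diamondsuit\}$, where $\diamondsuit\notin\Sigma$ is a hole. For $a,b\in\Sigma\cup\{\diamondsuit\}$, $a\approx b$ if $a=b$ or one of them is $\diamondsuit$. A positive integer $r$ is a (strong) period of a partial word $X$ if there is $P\in\Sigma^r$ with $X[i]\approx P[i\bmod r]$ for all positions $i$. $H(n,p,q)$ is the minimum number of holes in a partial word of length $n$ that has periods $p$ and $q$ but not period $\gcd(p,q)$ ($+\infty$ if none exists). $H^s(n,p,q)=\lfloor (n-q)/p\rfloor+\lfloor (n-q+1)/p\rfloor$. -}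

module Defs where

open import Data.Nat using (ℕ; zero; suc; _+_; _∸_; _≤_; _/_)
open import Data.Nat.DivMod using (_mod_)
open import Data.Nat.GCD using (gcd)
open import Data.Fin using (Fin; toℕ) renaming (zero to fz; suc to fs)
open import Data.Maybe using (Maybe; just; nothing)
open import Data.Product using (Σ; ∃; _×_)
open import Data.Empty using (⊥)
open import Data.Unit using (⊤)
open import Relation.Binary.PropositionalEquality using (_≡_)
open import Relation.Nullary using (¬_)

-- Alphabet Σ = ℕ; a letter of a partial word is `just a` (a ∈ Σ) or `nothing` (the hole ◇).
Letter : Set
Letter = Maybe ℕ

PWord : ℕ → Set
PWord n = Fin n → Letter

_≈_ : Letter → Letter → Set
nothing ≈ _ = ⊤
_ ≈ nothing = ⊤
just a ≈ just b = a ≡ b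

holes : ∀ {n} → PWord n → ℕ
holes {zero} X = 0
holes {suc n} X with X fz
... | nothing = suc (holes (λ i → X (fs i)))
... | just _ = holes (λ i → X (fs i))

HasPeriod : ∀ {n} → ℕ → PWord n → Set
HasPeriod zero X = ⊥
HasPeriod (suc r) X = Σ (Fin (suc r) → ℕ) λ P → ∀ i → X i ≈ just (P (toℕ i mod suc r))

-- H(n,p,q) ≤ k  (H is a minimum over a set of naturals, +∞ if empty):
-- some partial word of length n with periods p and q but not period gcd(p,q)
-- has at most k holes.
H≤ : ℕ → ℕ → ℕ → ℕ → Set
H≤ n p q k = Σ (PWord n) λ X →
  HasPeriod p X × HasPeriod q X × ¬ HasPeriod (gcd p q) X × holes X ≤ k

-- H^s(n,p,q) = ⌊(n-q)/p⌋ + ⌊(n-q+1)/p⌋  (only meaningful for p ≥ 1, n ≥ q)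
-- floor division ⌊m/d⌋ for d ≥ 1 (set to 0 for d = 0, never used)
_div_ : ℕ → ℕ → ℕ
m div zero = 0
m div suc d = m / suc d

Hs : ℕ → ℕ → ℕ → ℕ
Hs n p q = ((n ∸ q) div p) + ((n ∸ q + 1) div p)

module Submission where

-- Let u = q⁻¹ mod p and let w be the p-periodic 0/1 word with w j = 1 iff 1 ≤ (j+1)·u mod p ≤ p - u.
-- Since (j+q+1)·u ≡ (j+1)·u + 1 (mod p), w (j + q) = w j unless p divides j + 1 or j + 2;
-- call such j a cut point. The partial word of length n keeps w j at position j when w j agrees
-- with a reference value chosen for the residue class of j mod q, and has a hole otherwise.
-- It has period p (it is compatible with w) and period q (it is compatible with the references).
-- Each hole is charged to its own cut point below n - q; for holes at j ≥ 3q this uses that a cut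
-- at j - 2q propagates to j - q, which is where the upper bound on n enters. There are at most
-- ⌊(n-q)/p⌋ + ⌊(n-q+1)/p⌋ cut points below n - q, which is H^s(n,p,q). Finally the word still
-- contains the letters 0 and 1, so it does not have period gcd(p,q) = 1.

open import Defs
open import Data.Nat using (ℕ; zero; suc; z<s; s<s; _+_; _*_; _∸_; _≤_; _<_; z≤n; s≤s; NonZero; _%_; _/_; _<?_; _≤?_; _≟_)
open import Data.Nat.Properties
open import Data.Nat.DivMod
  using (m≡m%n+[m/n]*n; m%n<n; [m+kn]%n≡m%n; [m+n]%n≡m%n; n%n≡0; m<n⇒m%n≡m; m%n%n≡m%n; m*n%n≡0;
         %-distribˡ-*; %-distribˡ-+; %-pred-≡0; m/n*n≤m; m<n⇒m/n≡0; n/n≡1; m*n/n≡m; 0/n≡0; +-distrib-/-∣ʳ)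
open import Data.Nat.Divisibility using (n∣m*n)
open import Data.Nat.Coprimality using (Coprime; coprime-Bézout; coprime⇒gcd≡1)
open import Data.Nat.GCD using (gcd; module Bézout)
open import Data.Nat.Tactic.RingSolver using (solve-∀)
open import Data.Fin using (Fin; toℕ; fromℕ<) renaming (zero to fz)
open import Data.Fin.Properties using (toℕ-fromℕ<)
open import Data.Maybe using (just; nothing)
open import Data.Unit using (tt)
open import Data.Empty using (⊥-elim)
open import Data.Product using (∃-syntax; _×_; _,_; proj₁; proj₂)
open import Data.Sum using (_⊎_; inj₁; inj₂; [_,_])
open import Function using (id)
open import Relation.Nullary using (¬_; Dec; yes; no; contradiction)
open import Relation.Nullary.Decidable using (_⊎-dec_; decidable-stable)
open import Relation.Binary.PropositionalEquality hiding ([_])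

𝟙 : ∀ {a} {A : Set a} → Dec A → ℕ
𝟙 (yes _) = 1
𝟙 (no _) = 0

𝟙-yes : ∀ {a} {A : Set a} → A → (d : Dec A) → 𝟙 d ≡ 1
𝟙-yes a (yes _) = refl
𝟙-yes a (no ¬a) = contradiction a ¬a

𝟙-no : ∀ {a} {A : Set a} → ¬ A → (d : Dec A) → 𝟙 d ≡ 0
𝟙-no ¬a (yes a) = contradiction a ¬a
𝟙-no ¬a (no _) = refl

𝟙-cong : ∀ {a b} {A : Set a} {B : Set b} → (A → B) → (B → A) → (da : Dec A) (db : Dec B) → 𝟙 da ≡ 𝟙 db
𝟙-cong f g (yes _) (yes _) = refl
𝟙-cong f g (no _) (no _) = refl
𝟙-cong f g (yes a) (no ¬b) = contradiction (f a) ¬b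
𝟙-cong f g (no ¬a) (yes b) = contradiction (g b) ¬a

𝟙-⊎ : ∀ {a b} {A : Set a} {B : Set b} (da : Dec A) (db : Dec B) → 𝟙 (da ⊎-dec db) ≤ 𝟙 da + 𝟙 db
𝟙-⊎ (yes _) db = s≤s z≤n
𝟙-⊎ (no _) (yes _) = s≤s z≤n
𝟙-⊎ (no _) (no _) = z≤n

∑< : ℕ → (ℕ → ℕ) → ℕ
∑< zero f = 0
∑< (suc n) f = f 0 + ∑< n (λ i → f (suc i))

∑<-split : ∀ a b f → ∑< (a + b) f ≡ ∑< a f + ∑< b (λ i → f (a + i))
∑<-split zero b f = refl
∑<-split (suc a) b f = trans (cong (f 0 +_) (∑<-split a b (λ i → f (suc i)))) (sym (+-assoc (f 0) _ _))

∑<-snoc : ∀ n f → ∑< (suc n) f ≡ ∑< n f + f n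
∑<-snoc n f = begin
    ∑< (suc n) f                     ≡⟨ cong (λ k → ∑< k f) (+-comm 1 n) ⟩
    ∑< (n + 1) f                     ≡⟨ ∑<-split n 1 f ⟩
    ∑< n f + (f (n + 0) + 0)         ≡⟨ cong (λ x → ∑< n f + x) (trans (+-identityʳ _) (cong f (+-identityʳ n))) ⟩
    ∑< n f + f n                     ∎
  where open ≡-Reasoning

∑<-mono : ∀ n f g → (∀ i → i < n → f i ≤ g i) → ∑< n f ≤ ∑< n g
∑<-mono zero f g f≤g = z≤n
∑<-mono (suc n) f g f≤g = +-mono-≤ (f≤g 0 z<s) (∑<-mono n _ _ (λ i i<n → f≤g (suc i) (s<s i<n)))

∑<-vanish : ∀ n f → (∀ i → i < n → f i ≡ 0) → ∑< n f ≡ 0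
∑<-vanish zero f f≡0 = refl
∑<-vanish (suc n) f f≡0 rewrite f≡0 0 z<s = ∑<-vanish n _ (λ i i<n → f≡0 (suc i) (s<s i<n))

∑<-+ : ∀ n f g → ∑< n (λ i → f i + g i) ≡ ∑< n f + ∑< n g
∑<-+ zero f g = refl
∑<-+ (suc n) f g rewrite ∑<-+ n (λ i → f (suc i)) (λ i → g (suc i)) = interchange (f 0) (g 0) _ _
  where
    interchange : ∀ a b c d → (a + b) + (c + d) ≡ (a + c) + (b + d)
    interchange = solve-∀

∑<-disjoint : ∀ q m a b f →
  (∀ j → j < q → a j ≤ f j) → (∀ j → j < q → m ≤ j → a j ≡ 0) →
  (∀ i → i < m → b i ≤ f i) → (∀ i → i < m → i < q → b i ≡ 0) →
  ∑< q a + ∑< m b ≤ ∑< m f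
∑<-disjoint q m a b f a≤f a-out b≤f b-out with m ≤? q
... | yes m≤q = begin
    ∑< q a + ∑< m b                                    ≡⟨ cong₂ _+_ (cong (λ k → ∑< k a) (sym (m+[n∸m]≡n m≤q))) b≡0 ⟩
    ∑< (m + (q ∸ m)) a + 0                             ≡⟨ +-identityʳ _ ⟩
    ∑< (m + (q ∸ m)) a                                 ≡⟨ ∑<-split m (q ∸ m) a ⟩
    ∑< m a + ∑< (q ∸ m) (λ i → a (m + i))              ≡⟨ cong (∑< m a +_) tail≡0 ⟩
    ∑< m a + 0                                         ≡⟨ +-identityʳ _ ⟩
    ∑< m a                                             ≤⟨ ∑<-mono m a f (λ j j<m → a≤f j (<-≤-trans j<m m≤q)) ⟩
    ∑< m f                                             ∎
  where
    open ≤-Reasoning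
    b≡0 : ∑< m b ≡ 0
    b≡0 = ∑<-vanish m b (λ i i<m → b-out i i<m (<-≤-trans i<m m≤q))
    tail≡0 : ∑< (q ∸ m) (λ i → a (m + i)) ≡ 0
    tail≡0 = ∑<-vanish (q ∸ m) _ (λ i i<q∸m →
      a-out (m + i) (subst (m + i <_) (m+[n∸m]≡n m≤q) (+-monoʳ-< m i<q∸m)) (m≤m+n m i))
... | no m≰q = begin
    ∑< q a + ∑< m b                                    ≡⟨ cong (λ k → ∑< q a + ∑< k b) (sym (m+[n∸m]≡n q≤m)) ⟩
    ∑< q a + ∑< (q + (m ∸ q)) b                        ≡⟨ cong (∑< q a +_) (∑<-split q (m ∸ q) b) ⟩
    ∑< q a + (∑< q b + ∑< (m ∸ q) (λ i → b (q + i)))   ≡⟨ cong (λ x → ∑< q a + (x + ∑< (m ∸ q) (λ i → b (q + i)))) head≡0 ⟩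
    ∑< q a + ∑< (m ∸ q) (λ i → b (q + i))              ≤⟨ +-mono-≤ (∑<-mono q a f a≤f) (∑<-mono (m ∸ q) _ _ tail≤f) ⟩
    ∑< q f + ∑< (m ∸ q) (λ i → f (q + i))              ≡⟨ sym (∑<-split q (m ∸ q) f) ⟩
    ∑< (q + (m ∸ q)) f                                 ≡⟨ cong (λ k → ∑< k f) (m+[n∸m]≡n q≤m) ⟩
    ∑< m f                                             ∎
  where
    open ≤-Reasoning
    q≤m : q ≤ m
    q≤m = <⇒≤ (≰⇒> m≰q)
    head≡0 : ∑< q b ≡ 0
    head≡0 = ∑<-vanish q b (λ i i<q → b-out i (<-≤-trans i<q q≤m) i<q)
    tail≤f : ∀ i → i < m ∸ q → b (q + i) ≤ f (q + i)
    tail≤f i i<m∸q = b≤f (q + i) (subst (q + i <_) (m+[n∸m]≡n q≤m) (+-monoʳ-< q i<m∸q))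

-- Division of a successor: the last, incomplete block of m contributes suc (m % p).
suc-div-mod : ∀ p .{{_ : NonZero p}} m →
  suc m / p ≡ suc (m % p) / p + m / p × suc m % p ≡ suc (m % p) % p
suc-div-mod p m = quotient , trans (cong (λ x → suc x % p) (m≡m%n+[m/n]*n m p)) ([m+kn]%n≡m%n (suc (m % p)) (m / p) p)
  where
    open ≡-Reasoning
    quotient : suc m / p ≡ suc (m % p) / p + m / p
    quotient = begin
      suc m / p                             ≡⟨ cong (λ x → suc x / p) (m≡m%n+[m/n]*n m p) ⟩
      (suc (m % p) + m / p * p) / p         ≡⟨ +-distrib-/-∣ʳ (suc (m % p)) (n∣m*n (m / p)) ⟩
      suc (m % p) / p + m / p * p / p       ≡⟨ cong (suc (m % p) / p +_) (m*n/n≡m (m / p) p) ⟩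
      suc (m % p) / p + m / p               ∎

/-suc : ∀ p .{{_ : NonZero p}} m → suc m / p ≡ m / p + 𝟙 (suc m % p ≟ 0)
/-suc p m = by-cases (m≤n⇒m<n∨m≡n (m%n<n m p))
  where
    open ≡-Reasoning
    quotient = proj₁ (suc-div-mod p m)
    remainder = proj₂ (suc-div-mod p m)
    by-cases : suc (m % p) < p ⊎ suc (m % p) ≡ p → suc m / p ≡ m / p + 𝟙 (suc m % p ≟ 0)
    by-cases (inj₁ r+1<p) = begin
      suc m / p                   ≡⟨ quotient ⟩
      suc (m % p) / p + m / p     ≡⟨ cong (_+ m / p) (m<n⇒m/n≡0 r+1<p) ⟩
      m / p                       ≡⟨ sym (+-identityʳ _) ⟩
      m / p + 0                   ≡⟨ cong (m / p +_) (sym (𝟙-no not-multiple (suc m % p ≟ 0))) ⟩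
      m / p + 𝟙 (suc m % p ≟ 0)   ∎
      where
        not-multiple : suc m % p ≢ 0
        not-multiple e = 1+n≢0 (trans (sym (trans remainder (m<n⇒m%n≡m r+1<p))) e)
    by-cases (inj₂ r+1≡p) = begin
      suc m / p                   ≡⟨ quotient ⟩
      suc (m % p) / p + m / p     ≡⟨ cong (λ x → x / p + m / p) r+1≡p ⟩
      p / p + m / p               ≡⟨ cong (_+ m / p) (n/n≡1 p) ⟩
      1 + m / p                   ≡⟨ +-comm 1 _ ⟩
      m / p + 1                   ≡⟨ cong (m / p +_) (sym (𝟙-yes multiple (suc m % p ≟ 0))) ⟩
      m / p + 𝟙 (suc m % p ≟ 0)   ∎
      where
        multiple : suc m % p ≡ 0
        multiple = trans remainder (trans (cong (_% p) r+1≡p) (n%n≡0 p))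

count-multiples : ∀ p .{{_ : NonZero p}} m → ∑< m (λ i → 𝟙 (suc i % p ≟ 0)) ≡ m / p
count-multiples p zero = sym (0/n≡0 p)
count-multiples p (suc m) = begin
    ∑< (suc m) (λ i → 𝟙 (suc i % p ≟ 0))                ≡⟨ ∑<-snoc m _ ⟩
    ∑< m (λ i → 𝟙 (suc i % p ≟ 0)) + 𝟙 (suc m % p ≟ 0)  ≡⟨ cong (_+ 𝟙 (suc m % p ≟ 0)) (count-multiples p m) ⟩
    m / p + 𝟙 (suc m % p ≟ 0)                           ≡⟨ sym (/-suc p m) ⟩
    suc m / p                                           ∎
  where open ≡-Reasoning

-- For p > 1 the number of i < m with p ∣ i + 2 is ⌊(m+1)/p⌋ (the index -1 is not a multiple).
count-multiples-shifted : ∀ p .{{_ : NonZero p}} → 1 < p → ∀ m →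
  ∑< m (λ i → 𝟙 (suc (suc i) % p ≟ 0)) ≡ (m + 1) / p
count-multiples-shifted p 1<p m = begin
    ∑< m (λ i → 𝟙 (suc (suc i) % p ≟ 0))      ≡⟨ cong (_+ ∑< m (λ i → 𝟙 (suc (suc i) % p ≟ 0))) (sym (𝟙-no 1%p≢0 (1 % p ≟ 0))) ⟩
    ∑< (suc m) (λ i → 𝟙 (suc i % p ≟ 0))      ≡⟨ count-multiples p (suc m) ⟩
    suc m / p                                 ≡⟨ cong (_/ p) (+-comm 1 m) ⟩
    (m + 1) / p                               ∎
  where
    open ≡-Reasoning
    1%p≢0 : 1 % p ≢ 0
    1%p≢0 e = 1+n≢0 (trans (sym (m<n⇒m%n≡m 1<p)) e)

isHole : Letter → ℕ
isHole nothing = 1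
isHole (just _) = 0

holes-∑ : ∀ n (f : ℕ → Letter) → holes {n} (λ i → f (toℕ i)) ≡ ∑< n (λ j → isHole (f j))
holes-∑ zero f = refl
holes-∑ (suc n) f with f 0
... | nothing = cong suc (holes-∑ n (λ j → f (suc j)))
... | just _ = holes-∑ n (λ j → f (suc j))

compatible⇒period : ∀ {n} r (X : PWord n) (P : ℕ → ℕ) →
  (∀ i → X i ≈ just (P (toℕ i % suc r))) → HasPeriod (suc r) X
compatible⇒period r X P compatible = (λ a → P (toℕ a)) , λ i →
  subst (λ k → X i ≈ just (P k)) (sym (toℕ-fromℕ< (m%n<n (toℕ i) (suc r)))) (compatible i)

different-letters⇒¬period-1 : ∀ {n} (X : PWord n) {i k : Fin n} {a b : ℕ} →
  X i ≡ just a → X k ≡ just b → a ≢ b → ¬ HasPeriod 1 X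
different-letters⇒¬period-1 X {i} {k} Xi≡a Xk≡b a≢b (P , compatible) =
  a≢b (trans (letter-value Xi≡a (compatible i)) (trans (cong P (one-class _ _)) (sym (letter-value Xk≡b (compatible k)))))
  where
    letter-value : ∀ {x : Letter} {a c} → x ≡ just a → x ≈ just c → a ≡ c
    letter-value refl a≡c = a≡c
    one-class : (x y : Fin 1) → x ≡ y
    one-class fz fz = refl

*-%-absorb : ∀ p .{{_ : NonZero p}} a b → (a * (b % p)) % p ≡ (a * b) % p
*-%-absorb p a b = begin
    (a * (b % p)) % p              ≡⟨ %-distribˡ-* a (b % p) p ⟩
    ((a % p) * (b % p % p)) % p    ≡⟨ cong (λ x → ((a % p) * x) % p) (m%n%n≡m%n b p) ⟩
    ((a % p) * (b % p)) % p        ≡⟨ sym (%-distribˡ-* a b p) ⟩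
    (a * b) % p                    ∎
  where open ≡-Reasoning

reduce-mod : ∀ p .{{_ : NonZero p}} {x y} k → x ≡ y + k * p → x % p ≡ y % p
reduce-mod p {y = y} k refl = [m+kn]%n≡m%n y k p

multiple-in-range : ∀ p .{{_ : NonZero p}} {x} → 0 < x → x ≤ p → x % p ≡ 0 → x ≡ p
multiple-in-range p {x} 0<x x≤p x%p≡0 = [ below , id ] (m≤n⇒m<n∨m≡n x≤p)
  where
    below : x < p → x ≡ p
    below x<p = contradiction (trans (sym (m<n⇒m%n≡m x<p)) x%p≡0) (n>0⇒n≢0 0<x)

inverse-mod : ∀ p q .{{_ : NonZero p}} → 1 < p → Coprime p q → ∃[ u ] u < p × (q * u) % p ≡ 1
inverse-mod (suc zero) q (s≤s ()) cop
inverse-mod (suc (suc k)) q _ cop = from-Bézout (coprime-Bézout cop)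
  where
    open ≡-Reasoning
    p = suc (suc k)
    reorder : ∀ a b c → a * (b * c) ≡ b * (c * a)
    reorder = solve-∀
    square : ∀ k → (1 + k) * (1 + k) ≡ 1 + k * (2 + k)
    square = solve-∀
    from-Bézout : Bézout.Identity 1 p q → ∃[ u ] u < p × (q * u) % p ≡ 1
    from-Bézout (Bézout.-+ x y eq) = y % p , m%n<n y p , (begin
      (q * (y % p)) % p    ≡⟨ *-%-absorb p q y ⟩
      (q * y) % p          ≡⟨ cong (_% p) (*-comm q y) ⟩
      (y * q) % p          ≡⟨ cong (_% p) (sym eq) ⟩
      (1 + x * p) % p      ≡⟨ [m+kn]%n≡m%n 1 x p ⟩
      1                    ∎)
    from-Bézout (Bézout.+- x y eq) = (suc k * y) % p , m%n<n (suc k * y) p , (begin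
      (q * ((suc k * y) % p)) % p          ≡⟨ *-%-absorb p q (suc k * y) ⟩
      (q * (suc k * y)) % p                ≡⟨ cong (_% p) (reorder q (suc k) y) ⟩
      (suc k * (y * q)) % p                ≡⟨ %-distribˡ-* (suc k) (y * q) p ⟩
      ((suc k % p) * ((y * q) % p)) % p    ≡⟨ cong₂ (λ a b → (a * b) % p) (m<n⇒m%n≡m (n<1+n (suc k))) yq≡-1 ⟩
      (suc k * suc k) % p                  ≡⟨ reduce-mod p k (square k) ⟩
      1                                    ∎)
      where
        -- y·q ≡ -1 (mod p), since 1 + y·q = x·p
        yq≡-1 : (y * q) % p ≡ suc k
        yq≡-1 = %-pred-≡0 {y * q} (trans (cong (_% p) eq) (m*n%n≡0 x p))

Cut : ∀ p .{{_ : NonZero p}} → ℕ → Set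
Cut p j = suc j % p ≡ 0 ⊎ suc (suc j) % p ≡ 0

cut? : ∀ p .{{_ : NonZero p}} j → Dec (Cut p j)
cut? p j = (suc j % p ≟ 0) ⊎-dec (suc (suc j) % p ≟ 0)

-- At most ⌊m/p⌋ + ⌊(m+1)/p⌋ indices below m are cut points; this is where H^s comes from.
count-cuts : ∀ p .{{_ : NonZero p}} → 1 < p → ∀ m → ∑< m (λ i → 𝟙 (cut? p i)) ≤ m / p + (m + 1) / p
count-cuts p 1<p m = begin
    ∑< m (λ i → 𝟙 (cut? p i))                                            ≤⟨ ∑<-mono m _ _ (λ i _ → 𝟙-⊎ (suc i % p ≟ 0) (suc (suc i) % p ≟ 0)) ⟩
    ∑< m (λ i → 𝟙 (suc i % p ≟ 0) + 𝟙 (suc (suc i) % p ≟ 0))             ≡⟨ ∑<-+ m _ _ ⟩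
    ∑< m (λ i → 𝟙 (suc i % p ≟ 0)) + ∑< m (λ i → 𝟙 (suc (suc i) % p ≟ 0)) ≡⟨ cong₂ _+_ (count-multiples p m) (count-multiples-shifted p 1<p m) ⟩
    m / p + (m + 1) / p                                                  ∎
  where open ≤-Reasoning

hits-predecessor-of-multiple : ∀ p .{{_ : NonZero p}} a → ∃[ t ] t < p × suc (t + a) % p ≡ 0
hits-predecessor-of-multiple p a = t , ∸-monoʳ-< z<s (m%n<n a p) , (begin
    suc (t + a) % p                        ≡⟨ reduce-mod p (a / p) regroup ⟩
    (suc (a % p) + t) % p                  ≡⟨ cong (_% p) (m+[n∸m]≡n (m%n<n a p)) ⟩
    p % p                                  ≡⟨ n%n≡0 p ⟩
    0                                      ∎)
  where
    open ≡-Reasoning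
    t = p ∸ suc (a % p)
    shuffle : ∀ t r k → suc (t + (r + k)) ≡ (suc r + t) + k
    shuffle = solve-∀
    regroup : suc (t + a) ≡ (suc (a % p) + t) + a / p * p
    regroup = trans (cong (λ x → suc (t + x)) (m≡m%n+[m/n]*n a p)) (shuffle t (a % p) (a / p * p))

-- The arithmetic situation of cut-propagates below: writing q = r + d·p with r = q mod p,
-- the hypothesis b + 3q < n ≤ p + q + 2dp leaves room b + 2r < p.
module Room (p q n : ℕ) .{{_ : NonZero p}} (r≢0 : q % p ≢ 0) (n≤ : n ≤ p + q + 2 * p * (q / p))
            (b : ℕ) (b+3q<n : b + q + q + q < n) where
  r d : ℕ
  r = q % p
  d = q / p

  q≡r+dp : q ≡ r + d * p
  q≡r+dp = m≡m%n+[m/n]*n q p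

  b+2r<p : b + r + r < p
  b+2r<p = +-cancelʳ-< q _ p (+-cancelʳ-< (2 * p * d) _ (p + q) (subst (_< p + q + 2 * p * d) expand (<-≤-trans b+3q<n n≤)))
    where
      regroup : ∀ b r d p q → b + (r + d * p) + (r + d * p) + q ≡ b + r + r + q + 2 * p * d
      regroup = solve-∀
      expand : b + q + q + q ≡ b + r + r + q + 2 * p * d
      expand = trans (cong (λ x → b + x + x + q) q≡r+dp) (regroup b r d p q)

  b+r+1≤b+2r : suc (b + r) ≤ b + r + r
  b+r+1≤b+2r = m<m+n (b + r) (n≢0⇒n>0 r≢0)

  b+r+1<p : suc (b + r) < p
  b+r+1<p = ≤-<-trans b+r+1≤b+2r b+2r<p

  mod-b+q+1 : suc (b + q) % p ≡ suc (b + r) % p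
  mod-b+q+1 = reduce-mod p d (trans (cong (λ x → suc (b + x)) q≡r+dp) (shift b r (d * p)))
    where
      shift : ∀ b r k → suc (b + (r + k)) ≡ suc (b + r) + k
      shift = solve-∀

  mod-b+q+2 : suc (suc (b + q)) % p ≡ suc (suc (b + r)) % p
  mod-b+q+2 = reduce-mod p d (trans (cong (λ x → suc (suc (b + x))) q≡r+dp) (shift b r (d * p)))
    where
      shift : ∀ b r k → suc (suc (b + (r + k))) ≡ suc (suc (b + r)) + k
      shift = solve-∀

  mod-b+2q+1 : suc (b + q + q) % p ≡ suc (b + r + r) % p
  mod-b+2q+1 = reduce-mod p (d + d) (trans (cong (λ x → suc (b + x + x)) q≡r+dp) (shift b r d p))
    where
      shift : ∀ b r d p → suc (b + (r + d * p) + (r + d * p)) ≡ suc (b + r + r) + (d + d) * p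
      shift = solve-∀

-- For n ≤ p + q + 2p⌊q/p⌋ and r = q mod p ≥ 1, a cut at b + q forces a cut at b + 2q
-- whenever b + 3q < n: then b + 2r < p, so only p = b + r + 2 is possible, i.e. p ∣ b + 2q + 1.
cut-propagates : ∀ p q n .{{_ : NonZero p}} → q % p ≢ 0 → n ≤ p + q + 2 * p * (q / p) →
                 ∀ b → b + q + q + q < n → Cut p (b + q) → Cut p (b + q + q)
cut-propagates p q n r≢0 n≤ b b+3q<n (inj₁ cut) =
  ⊥-elim (<-irrefl (multiple-in-range p z<s (<⇒≤ b+r+1<p) (trans (sym mod-b+q+1) cut)) b+r+1<p)
  where open Room p q n r≢0 n≤ b b+3q<n
cut-propagates p q n r≢0 n≤ b b+3q<n (inj₂ cut) = inj₁ (begin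
    suc (b + q + q) % p     ≡⟨ mod-b+2q+1 ⟩
    suc (b + r + r) % p     ≡⟨ cong (_% p) b+2r+1≡p ⟩
    p % p                   ≡⟨ n%n≡0 p ⟩
    0                       ∎)
  where
    open ≡-Reasoning
    open Room p q n r≢0 n≤ b b+3q<n
    b+r+2≡p : suc (suc (b + r)) ≡ p
    b+r+2≡p = multiple-in-range p z<s b+r+1<p (trans (sym mod-b+q+2) cut)
    b+2r+1≡p : suc (b + r + r) ≡ p
    b+2r+1≡p = ≤-antisym b+2r<p (subst (_≤ suc (b + r + r)) b+r+2≡p (s≤s b+r+1≤b+2r))

length-≤-4q : ∀ p q n .{{_ : NonZero p}} → p < q → n ≤ p + q + 2 * p * (q / p) → n ≤ q + q + q + q
length-≤-4q p q n p<q n≤ = begin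
    n                                      ≤⟨ n≤ ⟩
    p + q + 2 * p * (q / p)                ≡⟨ cong (p + q +_) (double p (q / p)) ⟩
    p + q + (q / p * p + q / p * p)        ≤⟨ +-mono-≤ (+-monoˡ-≤ q (<⇒≤ p<q)) (+-mono-≤ (m/n*n≤m q p) (m/n*n≤m q p)) ⟩
    q + q + (q + q)                        ≡⟨ sym (+-assoc (q + q) q q) ⟩
    q + q + q + q                          ∎
  where
    open ≤-Reasoning
    double : ∀ p d → 2 * p * d ≡ d * p + d * p
    double = solve-∀

-- The p-periodic 0/1 word  w j = [1 ≤ (j+1)·u mod p ≤ p - u]  where u = q⁻¹ mod p.
-- Since (j+q+1)·u ≡ (j+1)·u + 1, shifting by q increases the phase by one, so w (j + q) = w j
-- except where the phase is 0 or p - u, i.e. at cut points.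
module StepWord (p q u : ℕ) .{{_ : NonZero p}} (u<p : u < p) (qu≡1 : (q * u) % p ≡ 1) where

  phase : ℕ → ℕ
  phase j = (suc j * u) % p

  v : ℕ
  v = p ∸ u

  0<v : 0 < v
  0<v = m<n⇒0<n∸m u<p

  v<p : v < p
  v<p = ∸-monoʳ-< (n≢0⇒n>0 u≢0) (<⇒≤ u<p)
    where
      u≢0 : u ≢ 0
      u≢0 refl = 0≢1+n (trans (sym (trans (cong (_% p) (*-zeroʳ q)) (m*n%n≡0 0 p))) qu≡1)

  step : ℕ → ℕ
  step zero = 0
  step (suc x) = 𝟙 (x <? v)

  w : ℕ → ℕ
  w j = step (phase j)

  phase-periodic : ∀ j → phase (j % p) ≡ phase j
  phase-periodic j = sym (reduce-mod p (j / p * u) (trans (cong (λ x → suc x * u) (m≡m%n+[m/n]*n j p)) (distribute (j % p) (j / p) u p)))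
    where
      distribute : ∀ r k u p → suc (r + k * p) * u ≡ suc r * u + k * u * p
      distribute = solve-∀

  w-periodic : ∀ j → w (j % p) ≡ w j
  w-periodic j = cong step (phase-periodic j)

  phase-shift : ∀ j → phase (j + q) ≡ suc (phase j) % p
  phase-shift j = begin
      (suc (j + q) * u) % p                      ≡⟨ cong (_% p) (distribute j q u) ⟩
      (suc j * u + q * u) % p                    ≡⟨ %-distribˡ-+ (suc j * u) (q * u) p ⟩
      (phase j + (q * u) % p) % p                ≡⟨ cong (λ x → (phase j + x) % p) qu≡1 ⟩
      (phase j + 1) % p                          ≡⟨ cong (_% p) (+-comm (phase j) 1) ⟩
      suc (phase j) % p                          ∎
    where
      open ≡-Reasoning
      distribute : ∀ j q u → suc (j + q) * u ≡ suc j * u + q * u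
      distribute = solve-∀

  -- u is invertible modulo p, so p ∣ x·u forces p ∣ x
  cancel-u : ∀ x → (x * u) % p ≡ 0 → x % p ≡ 0
  cancel-u x xu≡0 = begin
      x % p                                ≡⟨ sym (m%n%n≡m%n x p) ⟩
      (x % p) % p                          ≡⟨ cong (_% p) (sym (*-identityʳ (x % p))) ⟩
      (x % p * 1) % p                      ≡⟨ cong (λ y → (x % p * y) % p) (sym uq≡1) ⟩
      (x % p * ((u * q) % p)) % p          ≡⟨ sym (%-distribˡ-* x (u * q) p) ⟩
      (x * (u * q)) % p                    ≡⟨ cong (_% p) (sym (*-assoc x u q)) ⟩
      (x * u * q) % p                      ≡⟨ %-distribˡ-* (x * u) q p ⟩
      ((x * u) % p * (q % p)) % p          ≡⟨ cong (λ y → (y * (q % p)) % p) xu≡0 ⟩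
      0 % p                                ≡⟨ m*n%n≡0 0 p ⟩
      0                                    ∎
    where
      open ≡-Reasoning
      uq≡1 : (u * q) % p ≡ 1
      uq≡1 = trans (cong (_% p) (*-comm u q)) qu≡1

  phase≡0⇒cut : ∀ j → phase j ≡ 0 → suc j % p ≡ 0
  phase≡0⇒cut j = cancel-u (suc j)

  phase≡v⇒cut : ∀ j → phase j ≡ v → suc (suc j) % p ≡ 0
  phase≡v⇒cut j phase≡v = cancel-u (suc (suc j)) (begin
      (u + suc j * u) % p      ≡⟨ %-distribˡ-+ u (suc j * u) p ⟩
      (u % p + phase j) % p    ≡⟨ cong₂ (λ a b → (a + b) % p) (m<n⇒m%n≡m u<p) phase≡v ⟩
      (u + v) % p              ≡⟨ cong (_% p) (m+[n∸m]≡n (<⇒≤ u<p)) ⟩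
      p % p                    ≡⟨ n%n≡0 p ⟩
      0                        ∎)
    where open ≡-Reasoning

  step-shift : ∀ x → x < p → x ≢ 0 → x ≢ v → step (suc x % p) ≡ step x
  step-shift zero _ x≢0 _ = contradiction refl x≢0
  step-shift (suc y) y+1<p _ y+1≢v = by-cases (m≤n⇒m<n∨m≡n y+1<p)
    where
      by-cases : suc (suc y) < p ⊎ suc (suc y) ≡ p → step (suc (suc y) % p) ≡ step (suc y)
      by-cases (inj₁ y+2<p) = trans (cong step (m<n⇒m%n≡m y+2<p))
        (𝟙-cong (<-trans (n<1+n y)) (λ y<v → ≤∧≢⇒< y<v y+1≢v) (suc y <? v) (y <? v))
      by-cases (inj₂ y+2≡p) = trans (cong step (trans (cong (_% p) y+2≡p) (n%n≡0 p)))
        (sym (𝟙-no (λ y<v → y+1≢v (≤-antisym y<v (≤-pred (subst (v <_) (sym y+2≡p) v<p)))) (y <? v)))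

  jump : ∀ j → ¬ Cut p j → w (j + q) ≡ w j
  jump j no-cut = trans (cong step (phase-shift j))
    (step-shift (phase j) (m%n<n _ p) (λ e → no-cut (inj₁ (phase≡0⇒cut j e))) (λ e → no-cut (inj₂ (phase≡v⇒cut j e))))

  w-at-predecessor-of-multiple : ∀ j → suc j % p ≡ 0 → w j ≡ 0
  w-at-predecessor-of-multiple j e = cong step (begin
      (suc j * u) % p                ≡⟨ %-distribˡ-* (suc j) u p ⟩
      ((suc j % p) * (u % p)) % p    ≡⟨ cong (λ x → (x * (u % p)) % p) e ⟩
      0 % p                          ≡⟨ m*n%n≡0 0 p ⟩
      0                              ∎)
    where open ≡-Reasoning

  w-at-phase-one : ∀ j → phase j ≡ 1 → w j ≡ 1
  w-at-phase-one j e = trans (cong step e) (𝟙-yes 0<v (0 <? v))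

  -- q is invertible modulo p, so it is not a multiple of p
  q%p≢0 : q % p ≢ 0
  q%p≢0 q%p≡0 = 0≢1+n (trans (sym qu%p≡0) qu≡1)
    where
      qu%p≡0 : (q * u) % p ≡ 0
      qu%p≡0 = trans (%-distribˡ-* q u p) (trans (cong (λ x → (x * (u % p)) % p) q%p≡0) (m*n%n≡0 0 p))

-- Residue class b mod q gets the reference value ref b (its second occurrence if there is one,
-- else its first); position j carries w j when w j agrees with its reference and a hole otherwise.
-- Every hole is charged to a distinct cut point below n - q: a hole at j < q to j,
-- a hole at j ≥ 2q to j - q; positions in [q, 2q) are never holes.
module PartialWord (p q n : ℕ) .{{_ : NonZero p}} .{{_ : NonZero q}} (w : ℕ → ℕ)
       (jump : ∀ j → ¬ Cut p j → w (j + q) ≡ w j)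
       (q≤n : q ≤ n) (n≤4q : n ≤ q + q + q + q)
       (propagate : ∀ b → b + q + q + q < n → Cut p (b + q) → Cut p (b + q + q)) where

  ref : ℕ → ℕ
  ref b with b + q <? n
  ... | yes _ = w (b + q)
  ... | no _ = w b

  letter : ℕ → Letter
  letter j with w j ≟ ref (j % q)
  ... | yes _ = just (w j)
  ... | no _ = nothing

  ref-inside : ∀ b → b + q < n → ref b ≡ w (b + q)
  ref-inside b inside with b + q <? n
  ... | yes _ = refl
  ... | no outside = contradiction inside outside

  ref-outside : ∀ b → ¬ b + q < n → ref b ≡ w b
  ref-outside b outside with b + q <? n
  ... | yes inside = contradiction inside outside
  ... | no _ = refl

  letter-≈-w : ∀ j → letter j ≈ just (w j)
  letter-≈-w j with w j ≟ ref (j % q)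
  ... | yes _ = refl
  ... | no _ = tt

  letter-≈-ref : ∀ j → letter j ≈ just (ref (j % q))
  letter-≈-ref j with w j ≟ ref (j % q)
  ... | yes agrees = agrees
  ... | no _ = tt

  solid : ∀ j → w j ≡ ref (j % q) → letter j ≡ just (w j)
  solid j agrees with w j ≟ ref (j % q)
  ... | yes _ = refl
  ... | no disagrees = contradiction agrees disagrees

  -- a hole at j can be charged to any consequence P of the disagreement at j
  hole-charged : ∀ {P : Set} j → (w j ≢ ref (j % q) → P) → (d : Dec P) → isHole (letter j) ≤ 𝟙 d
  hole-charged j charge d with w j ≟ ref (j % q)
  ... | yes _ = z≤n
  ... | no disagrees = ≤-reflexive (sym (𝟙-yes (charge disagrees) d))

  cut-of-jump : ∀ j → w (j + q) ≢ w j → Cut p j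
  cut-of-jump j differs = decidable-stable (cut? p j) (λ no-cut → differs (jump j no-cut))

  residue : ∀ b → b < q → (b + q) % q ≡ b
  residue b b<q = trans ([m+n]%n≡m%n b q) (m<n⇒m%n≡m b<q)

  solid-low : ∀ j → j < q → n ≤ j + q → letter j ≡ just (w j)
  solid-low j j<q n≤j+q = solid j (sym (trans (cong ref (m<n⇒m%n≡m j<q)) (ref-outside j (≤⇒≯ n≤j+q))))

  solid-middle : ∀ b → b < q → b + q < n → letter (b + q) ≡ just (w (b + q))
  solid-middle b b<q inside = solid (b + q) (sym (trans (cong ref (residue b b<q)) (ref-inside b inside)))

  below-n : ∀ i → i < n ∸ q → i + q < n
  below-n i i<n-q = subst (i + q <_) (m∸n+n≡m q≤n) (+-monoˡ-< q i<n-q)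

  no-hole : ∀ {j a} → letter j ≡ just a → isHole (letter j) ≡ 0
  no-hole = cong isHole

  -- holes below q: a hole at j < q witnesses a jump at j, hence a cut at j
  hole-low : ∀ j → j < q → isHole (letter j) ≤ 𝟙 (cut? p j)
  hole-low j j<q with j + q <? n
  ... | no outside = ≤-trans (≤-reflexive (no-hole (solid-low j j<q (≮⇒≥ outside)))) z≤n
  ... | yes inside = hole-charged j (λ disagrees → cut-of-jump j (λ same → disagrees (begin
      w j                ≡⟨ sym same ⟩
      w (j + q)          ≡⟨ sym (ref-inside j inside) ⟩
      ref j              ≡⟨ cong ref (sym (m<n⇒m%n≡m j<q)) ⟩
      ref (j % q)        ∎))) (cut? p j)
    where open ≡-Reasoning

  no-hole-low : ∀ j → j < q → n ∸ q ≤ j → isHole (letter j) ≡ 0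
  no-hole-low j j<q n-q≤j = no-hole (solid-low j j<q (subst (_≤ j + q) (m∸n+n≡m q≤n) (+-monoˡ-≤ q n-q≤j)))

  no-hole-middle : ∀ i → i < n ∸ q → i < q → isHole (letter (q + i)) ≡ 0
  no-hole-middle i i<n-q i<q = trans (cong (λ k → isHole (letter k)) (+-comm q i)) (no-hole (solid-middle i i<q (below-n i i<n-q)))

  -- holes in [2q, 3q): a hole at b + 2q witnesses a jump at b + q
  hole-second : ∀ b → b < q → b + q + q < n → isHole (letter (b + q + q)) ≤ 𝟙 (cut? p (b + q))
  hole-second b b<q inside = hole-charged (b + q + q) (λ disagrees → cut-of-jump (b + q) (λ same → disagrees (begin
      w (b + q + q)             ≡⟨ same ⟩
      w (b + q)                 ≡⟨ sym (ref-inside b (≤-<-trans (m≤m+n (b + q) q) inside)) ⟩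
      ref b                     ≡⟨ cong ref (sym class) ⟩
      ref ((b + q + q) % q)     ∎))) (cut? p (b + q))
    where
      open ≡-Reasoning
      class : (b + q + q) % q ≡ b
      class = trans ([m+n]%n≡m%n (b + q) q) (residue b b<q)

  -- holes in [3q, 4q): a hole at b + 3q witnesses a jump at b + 2q, or else a jump at b + q,
  -- which propagates to a cut at b + 2q
  hole-third : ∀ b → b + q + q + q < n → isHole (letter (b + q + q + q)) ≤ 𝟙 (cut? p (b + q + q))
  hole-third b inside = hole-charged (b + q + q + q) charge (cut? p (b + q + q))
    where
      open ≡-Reasoning
      regroup : ∀ x q → x + q + q + q ≡ x + (q + q + q)
      regroup = solve-∀
      b<q : b < q
      b<q = +-cancelʳ-< (q + q + q) b q (subst₂ _<_ (regroup b q) (regroup q q) (<-≤-trans inside n≤4q))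
      b+q<n : b + q < n
      b+q<n = ≤-<-trans (≤-trans (m≤m+n (b + q) q) (m≤m+n (b + q + q) q)) inside
      class : (b + q + q + q) % q ≡ b
      class = trans ([m+n]%n≡m%n (b + q + q) q) (trans ([m+n]%n≡m%n (b + q) q) (residue b b<q))
      charge : w (b + q + q + q) ≢ ref ((b + q + q + q) % q) → Cut p (b + q + q)
      charge disagrees = decidable-stable (cut? p (b + q + q)) (λ no-cut →
        no-cut (propagate b inside (cut-of-jump (b + q) (λ same → disagrees (begin
          w (b + q + q + q)              ≡⟨ jump (b + q + q) no-cut ⟩
          w (b + q + q)                  ≡⟨ same ⟩
          w (b + q)                      ≡⟨ sym (ref-inside b b+q<n) ⟩
          ref b                          ≡⟨ cong ref (sym class) ⟩
          ref ((b + q + q + q) % q)      ∎)))))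

  data Block : ℕ → Set where
    first  : ∀ {i} → i < q → Block i
    second : ∀ {b} → b < q → Block (b + q)
    later  : ∀ b → Block (b + q + q)

  block : ∀ i → Block i
  block i with i <? q
  ... | yes i<q = first i<q
  ... | no i≮q with i ∸ q <? q
  ...   | yes b<q = subst Block (m∸n+n≡m (≮⇒≥ i≮q)) (second b<q)
  ...   | no b≮q = subst Block (trans (cong (_+ q) (m∸n+n≡m (≮⇒≥ b≮q))) (m∸n+n≡m (≮⇒≥ i≮q))) (later (i ∸ q ∸ q))

  hole-high : ∀ i → i + q < n → isHole (letter (i + q)) ≤ 𝟙 (cut? p i)
  hole-high i inside with block i
  ... | first i<q = ≤-trans (≤-reflexive (no-hole (solid-middle i i<q inside))) z≤n
  ... | second {b} b<q = hole-second b b<q inside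
  ... | later b = hole-third b inside

  hole-count : ∑< n (λ j → isHole (letter j)) ≤ ∑< (n ∸ q) (λ i → 𝟙 (cut? p i))
  hole-count = begin
      ∑< n hole                                             ≡⟨ cong (λ k → ∑< k hole) (sym (m+[n∸m]≡n q≤n)) ⟩
      ∑< (q + (n ∸ q)) hole                                 ≡⟨ ∑<-split q (n ∸ q) hole ⟩
      ∑< q hole + ∑< (n ∸ q) (λ i → hole (q + i))           ≤⟨ ∑<-disjoint q (n ∸ q) hole (λ i → hole (q + i)) (λ i → 𝟙 (cut? p i))
                                                                 hole-low no-hole-low hole-high′ no-hole-middle ⟩
      ∑< (n ∸ q) (λ i → 𝟙 (cut? p i))                       ∎
    where
      open ≤-Reasoning
      hole : ℕ → ℕ
      hole j = isHole (letter j)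
      hole-high′ : ∀ i → i < n ∸ q → hole (q + i) ≤ 𝟙 (cut? p i)
      hole-high′ i i<n-q = subst (λ k → hole k ≤ 𝟙 (cut? p i)) (+-comm i q) (hole-high i (below-n i i<n-q))

module Construction (p' q' n u : ℕ) (1<p : 1 < suc p') (p<q : suc p' < suc q')
                    (u<p : u < suc p') (qu≡1 : (suc q' * u) % suc p' ≡ 1)
                    (lo : p' + q' ≤ n) (hi : n ≤ suc p' + suc q' + 2 * suc p' * (suc q' / suc p')) where
  p q : ℕ
  p = suc p'
  q = suc q'

  open StepWord p q u u<p qu≡1 public

  q≤n : q ≤ n
  q≤n = ≤-trans (+-monoˡ-≤ q' (≤-pred 1<p)) lo

  open PartialWord p q n w jump q≤n (length-≤-4q p q n p<q hi) (cut-propagates p q n q%p≢0 hi) public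

  LettersZeroAndOne : Set
  LettersZeroAndOne = ∃[ j₀ ] ∃[ j₁ ] j₀ < n × j₁ < n × letter j₀ ≡ just 0 × letter j₁ ≡ just 1

  -- For n < p + q the positions p - 1 and q - 1 are below q and their classes have no second occurrence.
  letters-short : n < p + q → LettersZeroAndOne
  letters-short n<p+q = p' , q' , p'<n , q'<n , zero-at-p' , one-at-q'
    where
      p'<q' : p' < q'
      p'<q' = ≤-pred p<q
      p'<n : p' < n
      p'<n = <-≤-trans (m<m+n p' (≤-<-trans z≤n p'<q')) lo
      q'<n : q' < n
      q'<n = <-≤-trans (m<n+m q' (≤-pred 1<p)) lo
      n≤p'+q : n ≤ p' + q
      n≤p'+q = ≤-pred n<p+q
      zero-at-p' : letter p' ≡ just 0
      zero-at-p' = trans (solid-low p' (<-trans (n<1+n p') p<q) n≤p'+q)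
                         (cong just (w-at-predecessor-of-multiple p' (n%n≡0 p)))
      one-at-q' : letter q' ≡ just 1
      one-at-q' = trans (solid-low q' (n<1+n q') (≤-trans n≤p'+q (+-monoˡ-≤ q (<⇒≤ p'<q'))))
                        (cong just (w-at-phase-one q' qu≡1))

  phase-one-at-p'+q : phase (p' + q) ≡ 1
  phase-one-at-p'+q = trans (reduce-mod p u (regroup p' q u)) qu≡1
    where
      regroup : ∀ p' q u → suc (p' + q) * u ≡ q * u + u * suc p'
      regroup = solve-∀

  -- For n ≥ p + q the block [q, q + p) lies in [q, min(n, 2q)), where nothing is a hole,
  -- and contains a full period of w.
  letters-long : p + q ≤ n → LettersZeroAndOne
  letters-long p+q≤n = from-window (hits-predecessor-of-multiple p q)
    where
      from-window : ∃[ t ] t < p × suc (t + q) % p ≡ 0 → LettersZeroAndOne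
      from-window (t , t<p , multiple) = t + q , p' + q , t+q<n , p+q≤n , zero-at-t+q , one-at-p'+q
        where
          t+q<n : t + q < n
          t+q<n = <-≤-trans (+-monoˡ-< q t<p) p+q≤n
          zero-at-t+q : letter (t + q) ≡ just 0
          zero-at-t+q = trans (solid-middle t (<-trans t<p p<q) t+q<n)
                              (cong just (w-at-predecessor-of-multiple (t + q) multiple))
          one-at-p'+q : letter (p' + q) ≡ just 1
          one-at-p'+q = trans (solid-middle p' (<-trans (n<1+n p') p<q) p+q≤n)
                              (cong just (w-at-phase-one (p' + q) phase-one-at-p'+q))

  letters-zero-and-one : LettersZeroAndOne
  letters-zero-and-one = by-length (n <? p + q)
    where
      by-length : Dec (n < p + q) → LettersZeroAndOne
      by-length (yes n<p+q) = letters-short n<p+q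
      by-length (no n≮p+q) = letters-long (≮⇒≥ n≮p+q)

  word : PWord n
  word i = letter (toℕ i)

  no-period-1 : ¬ HasPeriod 1 word
  no-period-1 = from-letters letters-zero-and-one
    where
      at : ∀ {j a} (j<n : j < n) → letter j ≡ just a → word (fromℕ< j<n) ≡ just a
      at j<n = trans (cong letter (toℕ-fromℕ< j<n))
      from-letters : LettersZeroAndOne → ¬ HasPeriod 1 word
      from-letters (j₀ , j₁ , j₀<n , j₁<n , zero-at-j₀ , one-at-j₁) =
        different-letters⇒¬period-1 word (at j₀<n zero-at-j₀) (at j₁<n one-at-j₁) 0≢1+n

lemma8 : (p q : ℕ) → 1 < p → p < q → Coprime p q →
         (n : ℕ) → p + q ∸ 2 ≤ n → n ≤ p + q + 2 * p * (q div p) →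
         H≤ n p q (Hs n p q)
lemma8 zero q () _ _ _ _
lemma8 (suc p') zero _ () _ _ _ _
lemma8 p@(suc p') q@(suc q') 1<p p<q coprime n lo hi = from-inverse (inverse-mod p q 1<p coprime)
  where
    from-inverse : ∃[ u ] u < p × (q * u) % p ≡ 1 → H≤ n p q (Hs n p q)
    from-inverse (u , u<p , qu≡1) = word , period-p , period-q , no-gcd-period , few-holes
      where
        open Construction p' q' n u 1<p p<q u<p qu≡1 (subst (λ k → k ∸ 1 ≤ n) (+-suc p' q') lo) hi hiding (p; q)
        period-p : HasPeriod p word
        period-p = compatible⇒period p' word w (λ i → subst (λ k → letter (toℕ i) ≈ just k) (sym (w-periodic (toℕ i))) (letter-≈-w (toℕ i)))
        period-q : HasPeriod q word
        period-q = compatible⇒period q' word ref (λ i → letter-≈-ref (toℕ i))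
        no-gcd-period : ¬ HasPeriod (gcd p q) word
        no-gcd-period = subst (λ k → ¬ HasPeriod k word) (sym (coprime⇒gcd≡1 coprime)) no-period-1
        few-holes : holes word ≤ Hs n p q
        few-holes = begin
            holes word                           ≡⟨ holes-∑ n letter ⟩
            ∑< n (λ j → isHole (letter j))       ≤⟨ hole-count ⟩
            ∑< (n ∸ q) (λ i → 𝟙 (cut? p i))      ≤⟨ count-cuts p 1<p (n ∸ q) ⟩
            Hs n p q                             ∎
          where open ≤-Reasoning
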